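{- Consider the mixed-integer formulation described in the context. In this formulation the capacity limitation is enforced by constraints (F10) and (F11): for any assignment of the variables satisfying all constraints (F2)–(F12), every truck $t\in T$ satisfies the capacity limitation, i.e., at any time along its route $S_t$ the total volume of cargo carried by truck $t$ (the sum of $q_r$ over the requests $r\in D_t$ whose loading point $f(r)$ has already been visited by $t$ and whose unloading point $g(r)$ has not yet been visited) does not exceed $c^t$.
   Context: Profit-maximizing multi-vehicle pickup and delivery selection problem (location-based model). $V$ is a finite set of locations containing a depot $0$; $|V|$ denotes its cardinality. $T$ is a finite set of trucks, truck $t$ having capacity $c^t$ and arc costs $l^t_{od}$ ($o,d\in V$). $R$ is a finite set of requests; each $r\in R$ has a payment $w_r$, a volume $q_r$, a loading point $f(r)\in V\setminus\{0\}$ and an unloading point $g(r)\in V\setminus\{0\}$. Variables: $x^t_{od}$ ($t\in T$, $o,d\in V$; 1 iff truck $t$ traverses arc $(o,d)$), $y^t_r$ ($t\in T$, $r\in R$; 1 iff request $r$ is assigned to truck $t$), integers $u^t_v$ and $h^t_v$ ($t\in T$, $v\in V\setminus\{0\}$). Write $D_t=\{r: y^t_r=1\}$ and $S_t=\{(o,d): x^t_{od}=1\}$. The formulation maximizes $\sum_{r\in R}\sum_{t\in T}w_r y^t_r-\sum_{t\in T}\sum_{o,d\in V}l^t_{od}x^t_{od}$ subject to: (F2) $x^t_{od},y^t_r\in\{0,1\}$; (F3) $\sum_{t\in T}y^t_r\le 1$ for all $r$; (F4) $y^t_r\le\sum_{o\neq f(r)}x^t_{of(r)}$ for all $t,r$;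 (F5) $y^t_r\le\sum_{o\neq g(r)}x^t_{og(r)}$ for all $t,r$; (F6) $\sum_{d\in V}x^t_{od}-\sum_{d\in V}x^t_{do}=0$ for all $t$, $o\in V$; (F7) $\sum_{d\neq o}x^t_{od}\le 1$ for all $t$, $o\in V$; (F8) $u^t_d-u^t_o\ge 1-|V|(1-x^t_{od})$ for all $t$, $o,d\in V\setminus\{0\}$, $o\neq d$; (F9) $u^t_{f(r)}-u^t_{g(r)}<|V|(1-y^t_r)$ for all $t,r$; (F10) $\Gamma-M(1-x^t_{od})\le h^t_d-h^t_o\le\Gamma+M(1-x^t_{od})$ for all $t$, $o,d\in V\setminus\{0\}$, $o\neq d$, where $\Gamma=\sum_{r:\,f(r)=d}q_r y^t_r-\sum_{r:\,g(r)=d}q_r y^t_r$ and $M=c^t+\sum_{r\in R}q_r$; (F11) $0\le h^t_v\le c^t$ for all $t$, $v\in V\setminus\{0\}$; (F12) $0\le u^t_v\le |V|-2$ for all $t$, $v\in V\setminus\{0\}$. -}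

module Defs where

open import Data.Nat as ℕ using (ℕ; zero; suc)
open import Data.Fin as Fin using (Fin; zero; suc)
open import Data.Integer using (ℤ; +_; _+_; _-_; _*_; _≤_; _<_; 0ℤ; 1ℤ)
open import Data.Bool using (Bool; true; false; if_then_else_; _∧_; not)
open import Data.List using (List; []; _∷_)
open import Data.Product using (_×_)
open import Data.Sum using (_⊎_)
open import Data.Unit using (⊤)
open import Relation.Binary.PropositionalEquality using (_≡_; _≢_)
open import Relation.Nullary.Decidable using (⌊_⌋)

∑ : ∀ {k} → (Fin k → ℤ) → ℤ
∑ {zero} f = 0ℤ
∑ {suc k} f = f zero + ∑ (λ i → f (suc i))

∑≠ : ∀ {k} → Fin k → (Fin k → ℤ) → ℤ
∑≠ o f = ∑ (λ d → if ⌊ d Fin.≟ o ⌋ then 0ℤ else f d)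

-- Problem data.  Locations V = Fin (suc n) with depot zero (|V| = suc n);
-- trucks T = Fin m; requests R = Fin k.
record Instance : Set where
  field
    n m k : ℕ
    cap   : Fin m → ℕ
    cost  : Fin m → Fin (suc n) → Fin (suc n) → ℤ
    pay   : Fin k → ℤ
    vol   : Fin k → ℕ
    load  : Fin k → Fin (suc n)
    unld  : Fin k → Fin (suc n)
    load≢0 : ∀ r → load r ≢ zero
    unld≢0 : ∀ r → unld r ≢ zero

-- Values of the decision variables.  u, h are given on all of V; their
-- values at the depot play no role in any constraint.
record Assignment (I : Instance) : Set where
  open Instance I
  field
    x : Fin m → Fin (suc n) → Fin (suc n) → ℕ
    y : Fin m → Fin k → ℕ
    u : Fin m → Fin (suc n) → ℤ
    h : Fin m → Fin (suc n) → ℤ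

module _ {I : Instance} (A : Assignment I) where
  open Instance I
  open Assignment A
  open import Data.List.Membership.DecPropositional (Fin._≟_ {n = suc n}) using (_∈?_)

  ∣V∣ : ℤ
  ∣V∣ = + suc n

  xℤ : Fin m → Fin (suc n) → Fin (suc n) → ℤ
  xℤ t o d = + x t o d

  yℤ : Fin m → Fin k → ℤ
  yℤ t r = + y t r

  Γ : Fin m → Fin (suc n) → ℤ
  Γ t d = ∑ (λ r → if ⌊ load r Fin.≟ d ⌋ then + vol r * yℤ t r else 0ℤ)
        - ∑ (λ r → if ⌊ unld r Fin.≟ d ⌋ then + vol r * yℤ t r else 0ℤ)

  bigM : Fin m → ℤ
  bigM t = + cap t + ∑ (λ r → + vol r)

  record Feasible : Set where
    field
      F2x : ∀ t o d → x t o d ≡ 0 ⊎ x t o d ≡ 1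
      F2y : ∀ t r → y t r ≡ 0 ⊎ y t r ≡ 1
      F3  : ∀ r → ∑ (λ t → yℤ t r) ≤ 1ℤ
      F4  : ∀ t r → yℤ t r ≤ ∑≠ (load r) (λ o → xℤ t o (load r))
      F5  : ∀ t r → yℤ t r ≤ ∑≠ (unld r) (λ o → xℤ t o (unld r))
      F6  : ∀ t o → ∑ (λ d → xℤ t o d) - ∑ (λ d → xℤ t d o) ≡ 0ℤ
      F7  : ∀ t o → ∑≠ o (λ d → xℤ t o d) ≤ 1ℤ
      F8  : ∀ t (o d : Fin (suc n)) → o ≢ zero → d ≢ zero → o ≢ d →
              1ℤ - ∣V∣ * (1ℤ - xℤ t o d) ≤ u t d - u t o
      F9  : ∀ t r → u t (load r) - u t (unld r) < ∣V∣ * (1ℤ - yℤ t r)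
      F10 : ∀ t (o d : Fin (suc n)) → o ≢ zero → d ≢ zero → o ≢ d →
              (Γ t d - bigM t * (1ℤ - xℤ t o d) ≤ h t d - h t o) ×
              (h t d - h t o ≤ Γ t d + bigM t * (1ℤ - xℤ t o d))
      F11 : ∀ t (v : Fin (suc n)) → v ≢ zero → (0ℤ ≤ h t v) × (h t v ≤ + cap t)
      F12 : ∀ t (v : Fin (suc n)) → v ≢ zero →
              (0ℤ ≤ u t v) × (u t v ≤ ∣V∣ - + 2)

  WalkFrom : Fin m → Fin (suc n) → List (Fin (suc n)) → Set
  WalkFrom t prev [] = ⊤
  WalkFrom t prev (v ∷ vs) = x t prev v ≡ 1 × v ≢ zero × WalkFrom t v vs

  -- The list vs is the sequence of locations visited so far by truck t,
  -- leaving the depot (a "time" along the route S_t).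
  RoutePrefix : Fin m → List (Fin (suc n)) → Set
  RoutePrefix t vs = WalkFrom t zero vs

  Cargo : Fin m → List (Fin (suc n)) → ℤ
  Cargo t vs = ∑ (λ r → if ⌊ y t r ℕ.≟ 1 ⌋ ∧ ⌊ load r ∈? vs ⌋ ∧ not ⌊ unld r ∈? vs ⌋
                        then + vol r else 0ℤ)

{-# OPTIONS --safe #-}
-- Follow the route of truck t forward from the last location ℓ reached.  On an arc ℓ → d between
-- customers, (F10) gives h_d ≤ h_ℓ + Γ_d, while the cargo grows by at least Γ_d: u strictly
-- increases along the route (F8) and f(r) precedes g(r) (F9), so a request loaded at d has been
-- neither loaded nor unloaded before.  Hence cargo − h never decreases along the route.  As u stays
-- below |V| (F12), the route returns to the depot, and there the cargo is zero: the unloading point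
-- of an assigned request is entered (F5), following predecessors back (F6) strictly decreases u
-- until the depot is reached, and from the depot on the successors are unique (F7), so that point
-- lies on the route.  Thus cargo ≤ h_ℓ ≤ c^t by (F11).
module Submission where

open import Defs
open import Algebra.Bundles using (AbelianGroup)
open import Data.Bool using (true; false; if_then_else_; _∧_; _∨_; not)
open import Data.Bool.Properties using (if-eta; T-≡)
open import Data.Empty using (⊥-elim)
open import Data.Fin as Fin using (Fin; zero)
open import Data.Fin.Properties using (¬∀⟶∃¬)
open import Data.Integer as ℤ using (ℤ; +_; 0ℤ; 1ℤ; _+_; _-_; _*_; -_; _≤_; _<_; +≤+; +<+)
open import Data.Integer.Properties
open import Data.List using (List; []; _∷_; _++_; [_])
open import Data.List.Membership.Propositional using (_∈_; _∉_)
open import Data.List.Membership.Propositional.Properties using (++-∈⇔)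
open import Data.List.Relation.Unary.Any using (here; there)
open import Data.List.Relation.Unary.Any.Properties using (singleton⁻)
open import Data.Nat as ℕ using (suc; z≤n)
open import Data.Product using (∃-syntax; _×_; _,_; proj₁; proj₂)
open import Data.Sum using (_⊎_; inj₁; inj₂; fromInj₁; map₁; map₂)
open import Data.Unit using (tt)
open import Function using (_∘_; _⇔_; mk⇔; Equivalence)
open import Relation.Binary.Definitions using (DecidableEquality)
open import Relation.Binary.PropositionalEquality hiding ([_])
open import Relation.Nullary using (¬_; Dec; yes; no; does)
open import Relation.Nullary.Decidable
  using (⌊_⌋; isYes≗does; ⌊⌋-map′; dec-false; does-⇔; _⊎-dec_; toWitness)

open import Algebra.Properties.CommutativeSemigroup +-commutativeSemigroup
  using (interchange; x∙yz≈y∙xz)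
open import Algebra.Properties.Group (AbelianGroup.group +-0-abelianGroup)
  using (//-rightDividesˡ; //-rightDividesʳ; ∙-cancelˡ)

+-cancelʳ-≤ : ∀ c {a b} → a + c ≤ b + c → a ≤ b
+-cancelʳ-≤ c {a} {b} p =
  subst₂ _≤_ (//-rightDividesʳ c a) (//-rightDividesʳ c b) (+-monoˡ-≤ (- c) p)

-≤⇒≤+ : ∀ {a b c} → a - b ≤ c → a ≤ b + c
-≤⇒≤+ {a} {b} {c} p =
  subst₂ _≤_ (//-rightDividesˡ b a) (+-comm c b) (+-monoˡ-≤ b p)

1≤-⇒< : ∀ {a b} → 1ℤ ≤ b - a → a < b
1≤-⇒< {a} {b} p = suc[i]≤j⇒i<j (subst (1ℤ + a ≤_) (//-rightDividesˡ a b) (+-monoˡ-≤ a p))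

-<0⇒< : ∀ {a b} → a - b < 0ℤ → a < b
-<0⇒< {a} {b} p = subst₂ _<_ (//-rightDividesˡ b a) (+-identityˡ b) (+-monoˡ-< b p)

fuel-step : ∀ {c a b : ℤ} k → a < b → c ≤ a + + suc k → c ≤ b + + k
fuel-step {c} {a} {b} k a<b c≤ = ≤-trans c≤ (begin
  a + (1ℤ + + k)  ≡⟨ sym (+-assoc a 1ℤ (+ k)) ⟩
  a + 1ℤ + + k    ≡⟨ cong (_+ + k) (+-comm a 1ℤ) ⟩
  1ℤ + a + + k    ≤⟨ +-monoˡ-≤ (+ k) (i<j⇒suc[i]≤j a<b) ⟩
  b + + k         ∎)
  where open ≤-Reasoning

∑-cong : ∀ {k} {f g : Fin k → ℤ} → (∀ i → f i ≡ g i) → ∑ f ≡ ∑ g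
∑-cong {ℕ.zero} _ = refl
∑-cong {suc k} f≗g = cong₂ _+_ (f≗g zero) (∑-cong (f≗g ∘ Fin.suc))

∑-mono-≤ : ∀ {k} {f g : Fin k → ℤ} → (∀ i → f i ≤ g i) → ∑ f ≤ ∑ g
∑-mono-≤ {ℕ.zero} _ = ≤-refl
∑-mono-≤ {suc k} f≤g = +-mono-≤ (f≤g zero) (∑-mono-≤ (f≤g ∘ Fin.suc))

∑-nonneg : ∀ {k} {f : Fin k → ℤ} → (∀ i → 0ℤ ≤ f i) → 0ℤ ≤ ∑ f
∑-nonneg {ℕ.zero} _ = ≤-refl
∑-nonneg {suc k} f≥0 = +-mono-≤ (f≥0 zero) (∑-nonneg (f≥0 ∘ Fin.suc))

∑-nonpos : ∀ {k} {f : Fin k → ℤ} → (∀ i → f i ≤ 0ℤ) → ∑ f ≤ 0ℤ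
∑-nonpos {ℕ.zero} _ = ≤-refl
∑-nonpos {suc k} f≤0 = +-mono-≤ (f≤0 zero) (∑-nonpos (f≤0 ∘ Fin.suc))

∑-distrib-+ : ∀ {k} (f g : Fin k → ℤ) → ∑ (λ i → f i + g i) ≡ ∑ f + ∑ g
∑-distrib-+ {ℕ.zero} f g = refl
∑-distrib-+ {suc k} f g =
  trans (cong (_+_ (f zero + g zero)) (∑-distrib-+ (f ∘ Fin.suc) (g ∘ Fin.suc)))
        (interchange (f zero) (g zero) _ _)

∑-pos : ∀ {k} (f : Fin k → ℤ) → 0ℤ < ∑ f → ∃[ i ] 0ℤ < f i
∑-pos f ∑f>0 =
  let i , fᵢ≰0 = ¬∀⟶∃¬ _ (λ i → f i ≤ 0ℤ) (λ i → f i ≤? 0ℤ) (<⇒≱ ∑f>0 ∘ ∑-nonpos)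
  in i , ≰⇒> fᵢ≰0

-- ∑≠ i f unfolds to ∑ (zeroAt i f).
zeroAt : ∀ {k} → Fin k → (Fin k → ℤ) → Fin k → ℤ
zeroAt i f d = if ⌊ d Fin.≟ i ⌋ then 0ℤ else f d

zeroAt-≢ : ∀ {k} {i j : Fin k} (f : Fin k → ℤ) → j ≢ i → zeroAt i f j ≡ f j
zeroAt-≢ {i = i} {j} f j≢i with j Fin.≟ i
... | yes j≡i = ⊥-elim (j≢i j≡i)
... | no _ = refl

zeroAt-nonneg : ∀ {k} (i : Fin k) {f : Fin k → ℤ} → (∀ j → 0ℤ ≤ f j) → ∀ j → 0ℤ ≤ zeroAt i f j
zeroAt-nonneg i f≥0 j with j Fin.≟ i
... | yes _ = ≤-refl
... | no _ = f≥0 j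

∑≠-suc : ∀ {k} (i : Fin k) (f : Fin (suc k) → ℤ) → ∑≠ (Fin.suc i) f ≡ f zero + ∑≠ i (f ∘ Fin.suc)
∑≠-suc i f = cong (_+_ (f zero)) (∑-cong λ d →
  cong (if_then 0ℤ else f (Fin.suc d)) (⌊⌋-map′ _ _ (d Fin.≟ i)))

∑-split : ∀ {k} (f : Fin k → ℤ) (i : Fin k) → ∑ f ≡ f i + ∑≠ i f
∑-split f zero = cong (_+_ (f zero)) (sym (+-identityˡ _))
∑-split f (Fin.suc i) = begin
  f zero + ∑ (f ∘ Fin.suc)                   ≡⟨ cong (_+_ (f zero)) (∑-split (f ∘ Fin.suc) i) ⟩
  f zero + (f (Fin.suc i) + ∑≠ i (f ∘ Fin.suc))  ≡⟨ x∙yz≈y∙xz (f zero) (f (Fin.suc i)) _ ⟩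
  f (Fin.suc i) + (f zero + ∑≠ i (f ∘ Fin.suc))  ≡⟨ cong (_+_ (f (Fin.suc i))) (∑≠-suc i f) ⟨
  f (Fin.suc i) + ∑≠ (Fin.suc i) f               ∎
  where open ≡-Reasoning

term≤∑ : ∀ {k} {f : Fin k → ℤ} → (∀ j → 0ℤ ≤ f j) → ∀ i → f i ≤ ∑ f
term≤∑ {f = f} f≥0 i = begin
  f i                ≡⟨ sym (+-identityʳ (f i)) ⟩
  f i + 0ℤ           ≤⟨ +-monoʳ-≤ (f i) (∑-nonneg (zeroAt-nonneg i f≥0)) ⟩
  f i + ∑≠ i f       ≡⟨ sym (∑-split f i) ⟩
  ∑ f                ∎
  where open ≤-Reasoning

term≤∑≠ : ∀ {k} {f : Fin k → ℤ} → (∀ j → 0ℤ ≤ f j) → ∀ {i j} → j ≢ i → f j ≤ ∑≠ i f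
term≤∑≠ {f = f} f≥0 {i} {j} j≢i =
  subst (_≤ ∑≠ i f) (zeroAt-≢ f j≢i) (term≤∑ (zeroAt-nonneg i f≥0) j)

two-terms≤∑≠ : ∀ {k} {f : Fin k → ℤ} → (∀ j → 0ℤ ≤ f j) →
               ∀ {i j j′} → j ≢ i → j′ ≢ i → j′ ≢ j → f j + f j′ ≤ ∑≠ i f
two-terms≤∑≠ {f = f} f≥0 {i} {j} {j′} j≢i j′≢i j′≢j = begin
  f j + f j′                        ≡⟨ cong₂ _+_ (zeroAt-≢ f j≢i) (zeroAt-≢ f j′≢i) ⟨
  zeroAt i f j + zeroAt i f j′      ≤⟨ +-monoʳ-≤ (zeroAt i f j) (term≤∑≠ (zeroAt-nonneg i f≥0) j′≢j) ⟩
  zeroAt i f j + ∑≠ j (zeroAt i f)  ≡⟨ ∑-split (zeroAt i f) j ⟨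
  ∑≠ i f                            ∎
  where open ≤-Reasoning

∑≠-pos : ∀ {k} (i : Fin k) (f : Fin k → ℤ) → 0ℤ < ∑≠ i f → ∃[ j ] j ≢ i × 0ℤ < f j
∑≠-pos i f ∑≠>0 with ∑-pos (zeroAt i f) ∑≠>0
... | j , zeroAtⱼ>0 with j Fin.≟ i
...   | yes refl = ⊥-elim (<-irrefl refl zeroAtⱼ>0)
...   | no j≢i = j , j≢i , zeroAtⱼ>0

∑≠-balance : ∀ {k} (f g : Fin k → ℤ) (i : Fin k) → ∑ f ≡ ∑ g → f i ≡ g i → ∑≠ i f ≡ ∑≠ i g
∑≠-balance f g i ∑f≡∑g fᵢ≡gᵢ = ∙-cancelˡ (f i) (∑≠ i f) (∑≠ i g) (begin
  f i + ∑≠ i f   ≡⟨ sym (∑-split f i) ⟩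
  ∑ f            ≡⟨ ∑f≡∑g ⟩
  ∑ g            ≡⟨ ∑-split g i ⟩
  g i + ∑≠ i g   ≡⟨ cong (_+ ∑≠ i g) (sym fᵢ≡gᵢ) ⟩
  f i + ∑≠ i g   ∎)
  where open ≡-Reasoning

pos-transfer : ∀ {k} (f g : Fin k → ℤ) {i j : Fin k} → (∀ j → 0ℤ ≤ f j) → ∑≠ i f ≡ ∑≠ i g →
               j ≢ i → 0ℤ < f j → ∃[ j′ ] j′ ≢ i × 0ℤ < g j′
pos-transfer f g {i} f≥0 ∑≠f≡∑≠g j≢i fⱼ>0 =
  ∑≠-pos i g (subst (0ℤ <_) ∑≠f≡∑≠g (<-≤-trans fⱼ>0 (term≤∑≠ f≥0 j≢i)))

⌊⌋-false : ∀ {P : Set} (p? : Dec P) → ¬ P → ⌊ p? ⌋ ≡ false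
⌊⌋-false p? ¬p = trans (isYes≗does p?) (dec-false p? ¬p)

⌊⌋-true⇒ : ∀ {P : Set} (p? : Dec P) → ⌊ p? ⌋ ≡ true → P
⌊⌋-true⇒ p? ⌊p?⌋≡true = toWitness (Equivalence.from T-≡ ⌊p?⌋≡true)

if-nonneg : ∀ {q : ℤ} → 0ℤ ≤ q → ∀ c → 0ℤ ≤ (if c then q else 0ℤ)
if-nonneg q≥0 true = q≥0
if-nonneg q≥0 false = ≤-refl

-- Per request with volume q: a, b say whether f(r), g(r) were visited before d; a′, b′ whether
-- f(r) = d, g(r) = d.
indicator-step : ∀ (q : ℤ) → 0ℤ ≤ q → ∀ a b a′ b′ →
  (a′ ≡ true → a ≡ false × b ≡ false × b′ ≡ false) →
  (if a ∧ not b then q else 0ℤ) + (if a′ then q else 0ℤ) ≤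
  (if (a ∨ a′) ∧ not (b ∨ b′) then q else 0ℤ) + (if b′ then q else 0ℤ)
indicator-step q q≥0 a b true b′ fresh with fresh refl
... | refl , refl , refl = ≤-reflexive (+-comm 0ℤ q)
indicator-step q q≥0 true false false false _ = ≤-refl
indicator-step q q≥0 true false false true _ = ≤-reflexive (+-comm q 0ℤ)
indicator-step q q≥0 true true false b′ _ = +-monoʳ-≤ 0ℤ (if-nonneg q≥0 b′)
indicator-step q q≥0 false b false b′ _ = +-monoʳ-≤ 0ℤ (if-nonneg q≥0 b′)

endpoint : ∀ {A : Set} → A → List A → A
endpoint p [] = p
endpoint _ (v ∷ vs) = endpoint v vs

endpoint-snoc : ∀ {A : Set} (p : A) vs d → endpoint p (vs ++ [ d ]) ≡ d
endpoint-snoc p [] d = refl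
endpoint-snoc _ (v ∷ vs) d = endpoint-snoc v vs d

∈-snoc⇔ : ∀ {A : Set} {w d : A} vs → w ∈ vs ++ [ d ] ⇔ (w ∈ vs ⊎ w ≡ d)
∈-snoc⇔ vs = mk⇔ (map₂ singleton⁻ ∘ Equivalence.to ++-∈⇔)
                 (Equivalence.from (++-∈⇔ {xs = vs}) ∘ map₂ here)

module _ {A : Set} (_≟_ : DecidableEquality A) where
  open import Data.List.Membership.DecPropositional _≟_ using (_∈?_)

  ∈?-snoc : ∀ w vs d → ⌊ w ∈? (vs ++ [ d ]) ⌋ ≡ ⌊ w ∈? vs ⌋ ∨ ⌊ w ≟ d ⌋
  ∈?-snoc w vs d = begin
    ⌊ w ∈? (vs ++ [ d ]) ⌋         ≡⟨ isYes≗does _ ⟩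
    does (w ∈? (vs ++ [ d ]))      ≡⟨ does-⇔ (∈-snoc⇔ vs) (w ∈? (vs ++ [ d ])) ((w ∈? vs) ⊎-dec (w ≟ d)) ⟩
    does (w ∈? vs) ∨ does (w ≟ d)  ≡⟨ cong₂ _∨_ (isYes≗does (w ∈? vs)) (isYes≗does (w ≟ d)) ⟨
    ⌊ w ∈? vs ⌋ ∨ ⌊ w ≟ d ⌋        ∎
    where open ≡-Reasoning

big-M-inactive : ∀ (M : ℤ) {z} → z ≡ 1 → M * (1ℤ - + z) ≡ 0ℤ
big-M-inactive M refl = *-zeroʳ M

module Route {I : Instance} {A : Assignment I} (F : Feasible A) (t : Fin (Instance.m I)) where
  open Instance I
  open Assignment A
  open Feasible F
  open import Data.List.Membership.DecPropositional (Fin._≟_ {n = suc n}) using (_∈?_)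

  V : Set
  V = Fin (suc n)

  Arc : V → V → Set
  Arc o d = x t o d ≡ 1

  Walk : V → List V → Set
  Walk = WalkFrom A t

  outflow inflow : V → V → ℤ
  outflow v d = xℤ A t v d
  inflow v o = xℤ A t o v

  arc⇒pos : ∀ {o d} → Arc o d → 0ℤ < xℤ A t o d
  arc⇒pos od = subst (λ z → 0ℤ < + z) (sym od) (+<+ (ℕ.s≤s z≤n))

  pos⇒arc : ∀ {o d} → 0ℤ < xℤ A t o d → Arc o d
  pos⇒arc {o} {d} x>0 with F2x t o d
  ... | inj₁ x≡0 = ⊥-elim (<-irrefl refl (subst (λ z → 0ℤ < + z) x≡0 x>0))
  ... | inj₂ x≡1 = x≡1

  x-nonneg : ∀ o d → 0ℤ ≤ xℤ A t o d
  x-nonneg o d = +≤+ z≤n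

  successor-unique : ∀ {o a b} → Arc o a → a ≢ o → Arc o b → b ≢ o → a ≡ b
  successor-unique {o} {a} {b} oa a≢o ob b≢o with a Fin.≟ b
  ... | yes a≡b = a≡b
  ... | no a≢b = ⊥-elim (2≰1 (≤-trans two≤out (F7 t o)))
    where
    two≤out : + 2 ≤ ∑≠ o (outflow o)
    two≤out = subst (_≤ ∑≠ o (outflow o)) (cong₂ (λ p q → + p + + q) oa ob)
                (two-terms≤∑≠ (x-nonneg o) a≢o b≢o (a≢b ∘ sym))
    2≰1 : ¬ (+ 2 ≤ 1ℤ)
    2≰1 (+≤+ (ℕ.s≤s ()))

  outflow≡inflow : ∀ v → ∑≠ v (outflow v) ≡ ∑≠ v (inflow v)
  outflow≡inflow v = ∑≠-balance (outflow v) (inflow v) v (i-j≡0⇒i≡j _ _ (F6 t v)) refl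

  exit-arc : ∀ {p v} → Arc p v → p ≢ v → ∃[ d ] d ≢ v × Arc v d
  exit-arc {p} {v} pv p≢v =
    let d , d≢v , x>0 = pos-transfer (inflow v) (outflow v) (λ o → x-nonneg o v)
                          (sym (outflow≡inflow v)) p≢v (arc⇒pos pv)
    in d , d≢v , pos⇒arc x>0

  entry-arc : ∀ {v d} → Arc v d → d ≢ v → ∃[ p ] p ≢ v × Arc p v
  entry-arc {v} {d} vd d≢v =
    let p , p≢v , x>0 = pos-transfer (outflow v) (inflow v) (x-nonneg v)
                          (outflow≡inflow v) d≢v (arc⇒pos vd)
    in p , p≢v , pos⇒arc x>0

  u-increasing : ∀ {o d} → o ≢ zero → d ≢ zero → o ≢ d → Arc o d → u t o < u t d
  u-increasing {o} {d} o≢0 d≢0 o≢d od =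
    1≤-⇒< (subst (λ z → 1ℤ - z ≤ u t d - u t o) (big-M-inactive (∣V∣ A) od)
                 (F8 t o d o≢0 d≢0 o≢d))

  u<∣V∣ : ∀ {w} → w ≢ zero → u t w < ∣V∣ A
  u<∣V∣ {w} w≢0 = ≤-<-trans (proj₂ (F12 t w w≢0)) ∣V∣-2<∣V∣
    where
    ∣V∣-2<∣V∣ : ∣V∣ A - + 2 < ∣V∣ A
    ∣V∣-2<∣V∣ = subst (∣V∣ A - + 2 <_) (+-identityʳ (∣V∣ A)) (+-monoʳ-< (∣V∣ A) (ℤ.-<+ {1} {0}))

  load-before-unload : ∀ {r} → y t r ≡ 1 → u t (load r) < u t (unld r)
  load-before-unload {r} y≡1 =
    -<0⇒< (subst (u t (load r) - u t (unld r) <_) (big-M-inactive (∣V∣ A) y≡1) (F9 t r))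

  unload-entered : ∀ {r} → y t r ≡ 1 → ∃[ o ] o ≢ unld r × Arc o (unld r)
  unload-entered {r} y≡1 =
    let o , o≢g , x>0 = ∑≠-pos (unld r) (inflow (unld r))
                          (suc[i]≤j⇒i<j (subst (λ z → + z ≤ ∑≠ (unld r) (inflow (unld r))) y≡1
                                                (F5 t r)))
    in o , o≢g , pos⇒arc x>0

  h-step : ∀ {o d} → o ≢ zero → d ≢ zero → o ≢ d → Arc o d → h t d ≤ h t o + Γ A t d
  h-step {o} {d} o≢0 d≢0 o≢d od = -≤⇒≤+ (subst (h t d - h t o ≤_)
    (trans (cong (_+_ (Γ A t d)) (big-M-inactive (bigM A t) od)) (+-identityʳ _))
    (proj₂ (F10 t o d o≢0 d≢0 o≢d)))

  -- (F7) and (F8) say nothing about self-loops x^t_vv, so a walk may linger at a location; hence the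
  -- comparisons of v with prev below.
  arc-from-visited : ∀ {prev vs p w} → Walk prev vs → p ∈ prev ∷ vs → Arc p w → w ≢ p →
                     w ∈ vs ⊎ endpoint prev vs ≡ p
  arc-from-visited {vs = []} _ (here refl) _ _ = inj₂ refl
  arc-from-visited {prev} {v ∷ vs} (prev→v , _ , walk) (here refl) pw w≢p with v Fin.≟ prev
  ... | yes refl = map₁ there (arc-from-visited walk (here refl) pw w≢p)
  ... | no v≢prev = inj₁ (here (successor-unique pw w≢p prev→v v≢prev))
  arc-from-visited {vs = v ∷ vs} (_ , _ , walk) (there p∈) pw w≢p =
    map₁ there (arc-from-visited walk p∈ pw w≢p)

  u≤u-endpoint : ∀ {prev vs} → Walk prev vs → prev ≢ zero → u t prev ≤ u t (endpoint prev vs)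
  u≤u-endpoint {vs = []} _ _ = ≤-refl
  u≤u-endpoint {prev} {v ∷ vs} (prev→v , v≢0 , walk) prev≢0 with v Fin.≟ prev
  ... | yes refl = u≤u-endpoint walk v≢0
  ... | no v≢prev =
    ≤-trans (<⇒≤ (u-increasing prev≢0 v≢0 (v≢prev ∘ sym) prev→v)) (u≤u-endpoint walk v≢0)

  visited-u≤u-endpoint : ∀ {prev vs w} → Walk prev vs → w ∈ vs → u t w ≤ u t (endpoint prev vs)
  visited-u≤u-endpoint {vs = v ∷ vs} (_ , v≢0 , walk) (here refl) = u≤u-endpoint walk v≢0
  visited-u≤u-endpoint {vs = v ∷ vs} (_ , _ , walk) (there w∈) = visited-u≤u-endpoint walk w∈

  endpoint≢depot : ∀ {prev vs} → Walk prev vs → prev ≢ zero → endpoint prev vs ≢ zero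
  endpoint≢depot {vs = []} _ prev≢0 = prev≢0
  endpoint≢depot {vs = v ∷ vs} (_ , v≢0 , walk) _ = endpoint≢depot walk v≢0

  walk-snoc : ∀ {prev vs d} → Walk prev vs → Arc (endpoint prev vs) d → d ≢ zero →
              Walk prev (vs ++ [ d ])
  walk-snoc {vs = []} _ prev→d d≢0 = prev→d , d≢0 , tt
  walk-snoc {vs = v ∷ vs} (prev→v , v≢0 , walk) ℓ→d d≢0 = prev→v , v≢0 , walk-snoc walk ℓ→d d≢0

  entry-arc-endpoint : ∀ {prev vs} → Walk prev vs → endpoint prev vs ≢ prev →
                       ∃[ p ] p ≢ endpoint prev vs × Arc p (endpoint prev vs)
  entry-arc-endpoint {vs = []} _ ℓ≢prev = ⊥-elim (ℓ≢prev refl)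
  entry-arc-endpoint {prev} {v ∷ vs} (prev→v , _ , walk) ℓ≢prev with endpoint v vs Fin.≟ v
  ... | yes ℓ≡v = prev , ℓ≢prev ∘ sym , subst (Arc prev) (sym ℓ≡v) prev→v
  ... | no ℓ≢v = entry-arc-endpoint walk ℓ≢v

  entered⇒visited : ∀ fuel {vs p w} → Walk zero vs →
                    endpoint zero vs ≢ zero → Arc (endpoint zero vs) zero →
                    w ≢ zero → u t w < + fuel → Arc p w → w ≢ p → w ∈ vs
  entered⇒visited ℕ.zero {w = w} _ _ _ w≢0 uw<0 _ _ = ⊥-elim (<⇒≱ uw<0 (proj₁ (F12 t w w≢0)))
  entered⇒visited (suc fuel) {vs} {p} {w} walk ℓ≢0 ℓ→0 w≢0 uw<fuel pw w≢p with p Fin.≟ zero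
  ... | yes refl = fromInj₁ (⊥-elim ∘ ℓ≢0) (arc-from-visited walk (here refl) pw w≢p)
  ... | no p≢0 = fromInj₁ ℓ≡p⇒w∈vs (arc-from-visited walk (there p∈vs) pw w≢p)
    where
    up<uw : u t p < u t w
    up<uw = u-increasing p≢0 w≢0 (w≢p ∘ sym) pw
    p∈vs : p ∈ vs
    p∈vs = let p′ , p′≢p , p′p = entry-arc pw w≢p
           in entered⇒visited fuel walk ℓ≢0 ℓ→0 p≢0
                (<-≤-trans up<uw (i<j⇒i≤pred[j] uw<fuel)) p′p (p′≢p ∘ sym)
    ℓ≡p⇒w∈vs : endpoint zero vs ≡ p → w ∈ vs
    ℓ≡p⇒w∈vs refl = ⊥-elim (w≢0 (successor-unique pw w≢p ℓ→0 (ℓ≢0 ∘ sym)))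

  -- Cargo A t vs unfolds to ∑ (carried vs), and Γ A t d to ∑ (loadedAt d) - ∑ (unloadedAt d).
  carried : List V → Fin k → ℤ
  carried vs r = if ⌊ y t r ℕ.≟ 1 ⌋ ∧ ⌊ load r ∈? vs ⌋ ∧ not ⌊ unld r ∈? vs ⌋ then + vol r else 0ℤ

  loadedAt unloadedAt : V → Fin k → ℤ
  loadedAt d r = if ⌊ load r Fin.≟ d ⌋ then + vol r * yℤ A t r else 0ℤ
  unloadedAt d r = if ⌊ unld r Fin.≟ d ⌋ then + vol r * yℤ A t r else 0ℤ

  LoadedFresh : List V → V → Fin k → Set
  LoadedFresh vs d r = y t r ≡ 1 → load r ≡ d → load r ∉ vs × unld r ∉ vs × unld r ≢ d

  cargo-nonpos : ∀ {vs} → (∀ r → y t r ≡ 1 → load r ∈ vs → unld r ∈ vs) → Cargo A t vs ≤ 0ℤ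
  cargo-nonpos {vs} delivered = ∑-nonpos carried≤0
    where
    carried≤0 : ∀ r → carried vs r ≤ 0ℤ
    carried≤0 r with y t r ℕ.≟ 1 | load r ∈? vs | unld r ∈? vs
    ... | no _ | _ | _ = ≤-refl
    ... | yes _ | no _ | _ = ≤-refl
    ... | yes _ | yes _ | yes _ = ≤-refl
    ... | yes y≡1 | yes f∈ | no g∉ = ⊥-elim (g∉ (delivered r y≡1 f∈))

  carried-step : ∀ vs d r → LoadedFresh vs d r →
                 carried vs r + loadedAt d r ≤ carried (vs ++ [ d ]) r + unloadedAt d r
  carried-step vs d r fresh with y t r | F2y t r
  ... | _ | inj₁ refl =
    subst₂ (λ a b → 0ℤ + a ≤ 0ℤ + b) (sym (unassigned (load r))) (sym (unassigned (unld r))) ≤-refl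
    where
    unassigned : ∀ w → (if ⌊ w Fin.≟ d ⌋ then + vol r * 0ℤ else 0ℤ) ≡ 0ℤ
    unassigned w = trans (cong (if ⌊ w Fin.≟ d ⌋ then_else 0ℤ) (*-zeroʳ (+ vol r))) (if-eta _)
  ... | _ | inj₂ refl
    rewrite *-identityʳ (+ vol r) | ∈?-snoc Fin._≟_ (load r) vs d | ∈?-snoc Fin._≟_ (unld r) vs d =
    indicator-step (+ vol r) (+≤+ z≤n) _ _ _ _ fresh′
    where
    fresh′ : ⌊ load r Fin.≟ d ⌋ ≡ true →
             ⌊ load r ∈? vs ⌋ ≡ false × ⌊ unld r ∈? vs ⌋ ≡ false × ⌊ unld r Fin.≟ d ⌋ ≡ false
    fresh′ f≟d = let f∉ , g∉ , g≢d = fresh refl (⌊⌋-true⇒ (load r Fin.≟ d) f≟d)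
                 in ⌊⌋-false (load r ∈? vs) f∉ , ⌊⌋-false (unld r ∈? vs) g∉ ,
                    ⌊⌋-false (unld r Fin.≟ d) g≢d

  cargo-step : ∀ vs d → (∀ r → LoadedFresh vs d r) →
               Cargo A t vs + Γ A t d ≤ Cargo A t (vs ++ [ d ])
  cargo-step vs d fresh = +-cancelʳ-≤ (∑ (unloadedAt d)) (begin
    Cargo A t vs + Γ A t d + ∑ (unloadedAt d)
      ≡⟨ +-assoc (Cargo A t vs) (Γ A t d) _ ⟩
    Cargo A t vs + (Γ A t d + ∑ (unloadedAt d))
      ≡⟨ cong (_+_ (Cargo A t vs)) (//-rightDividesˡ (∑ (unloadedAt d)) (∑ (loadedAt d))) ⟩
    Cargo A t vs + ∑ (loadedAt d)
      ≡⟨ sym (∑-distrib-+ (carried vs) (loadedAt d)) ⟩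
    ∑ (λ r → carried vs r + loadedAt d r)
      ≤⟨ ∑-mono-≤ (λ r → carried-step vs d r (fresh r)) ⟩
    ∑ (λ r → carried (vs ++ [ d ]) r + unloadedAt d r)
      ≡⟨ ∑-distrib-+ (carried (vs ++ [ d ])) (unloadedAt d) ⟩
    Cargo A t (vs ++ [ d ]) + ∑ (unloadedAt d) ∎)
    where open ≤-Reasoning

  route-continues : ∀ {vs} → Walk zero vs → endpoint zero vs ≢ zero →
                    ∃[ d ] d ≢ endpoint zero vs × Arc (endpoint zero vs) d
  route-continues walk ℓ≢0 = let p , p≢ℓ , pℓ = entry-arc-endpoint walk ℓ≢0 in exit-arc pℓ p≢ℓ

  cargo-at-return : ∀ {vs} → Walk zero vs → endpoint zero vs ≢ zero → Arc (endpoint zero vs) zero →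
                    Cargo A t vs ≤ 0ℤ
  cargo-at-return {vs} walk ℓ≢0 ℓ→0 = cargo-nonpos delivered
    where
    delivered : ∀ r → y t r ≡ 1 → load r ∈ vs → unld r ∈ vs
    delivered r y≡1 _ =
      let o , o≢g , og = unload-entered y≡1
      in entered⇒visited (suc n) walk ℓ≢0 ℓ→0 (unld≢0 r) (u<∣V∣ (unld≢0 r)) og (o≢g ∘ sym)

  beyond-endpoint-fresh : ∀ {vs d} → Walk zero vs → u t (endpoint zero vs) < u t d →
                          ∀ r → LoadedFresh vs d r
  beyond-endpoint-fresh {vs} walk uℓ<ud r y≡1 refl =
    unvisited uℓ<ud , unvisited (<-trans uℓ<ud uf<ug) , <⇒≢ uf<ug ∘ cong (u t) ∘ sym
    where
    uf<ug = load-before-unload y≡1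
    unvisited : ∀ {w} → u t (endpoint zero vs) < u t w → w ∉ vs
    unvisited uℓ<uw w∈vs = <⇒≱ uℓ<uw (visited-u≤u-endpoint walk w∈vs)

  cargo≤h : ∀ fuel {vs ℓ} → Walk zero vs → endpoint zero vs ≡ ℓ → ℓ ≢ zero →
            ∣V∣ A ≤ u t ℓ + + fuel → Cargo A t vs ≤ h t ℓ
  cargo≤h fuel walk refl ℓ≢0 bound with route-continues walk ℓ≢0
  ... | d , d≢ℓ , ℓd with d Fin.≟ zero
  ... | yes refl = ≤-trans (cargo-at-return walk ℓ≢0 ℓd) (proj₁ (F11 t _ ℓ≢0))
  cargo≤h ℕ.zero walk refl ℓ≢0 bound | _ | no _ =
    ⊥-elim (<⇒≱ (u<∣V∣ ℓ≢0) (subst (∣V∣ A ≤_) (+-identityʳ _) bound))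
  cargo≤h (suc fuel) {vs} walk refl ℓ≢0 bound | d , d≢ℓ , ℓd | no d≢0 =
    +-cancelʳ-≤ (Γ A t d) (begin
      Cargo A t vs + Γ A t d            ≤⟨ cargo-step vs d (beyond-endpoint-fresh walk uℓ<ud) ⟩
      Cargo A t (vs ++ [ d ])           ≤⟨ cargo≤h fuel (walk-snoc walk ℓd d≢0) (endpoint-snoc zero vs d) d≢0
                                                       (fuel-step fuel uℓ<ud bound) ⟩
      h t d                             ≤⟨ h-step ℓ≢0 d≢0 (d≢ℓ ∘ sym) ℓd ⟩
      h t (endpoint zero vs) + Γ A t d  ∎)
    where
    open ≤-Reasoning
    uℓ<ud = u-increasing ℓ≢0 d≢0 (d≢ℓ ∘ sym) ℓd

theorem2 : (I : Instance) (A : Assignment I) → Feasible A →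
    (t : Fin (Instance.m I)) (vs : List (Fin (suc (Instance.n I)))) →
    RoutePrefix A t vs → Cargo A t vs ≤ + Instance.cap I t
theorem2 I A F t [] _ = ≤-trans (cargo-nonpos {vs = []} (λ _ _ ())) (+≤+ z≤n)
  where open Route F t
theorem2 I A F t (v ∷ vs) walk@(_ , v≢0 , walk′) =
  ≤-trans (cargo≤h (suc n) walk refl ℓ≢0 (+-monoˡ-≤ (+ suc n) (proj₁ (F12 t ℓ ℓ≢0))))
          (proj₂ (F11 t ℓ ℓ≢0))
  where
  open Instance I
  open Feasible F
  open Route F t
  ℓ = endpoint v vs
  ℓ≢0 : ℓ ≢ zero
  ℓ≢0 = endpoint≢depot walk′ v≢0
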